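{- For $m\geq 2$, the chromatic polynomial of the signed graph $B_m^1$ is $\chi_{B_m^1}(\lambda)=(\lambda-1)^2\gamma_m$, where $\gamma_m=\frac{(\lambda-1)^{m-1}-(-1)^{m-1}}{\lambda}=\sum_{i=0}^{m-2}(-1)^i(\lambda-1)^{m-2-i}$.
   Context: For $m\ge 3$, $B_m^1$ is the signed graph obtained from the cycle $u u_1 u_2\cdots u_{m-2} v u$ by replacing the edge $uv$ with two parallel edges between $u$ and $v$, one positive and one negative, all other edges being positive. By convention $B_2^1$ is the digon $C_2^-$ on $u,v$ with one positive and one negative edge. For a signed graph with sign function $\sigma$, a proper coloring with colors $\{ -k,\ldots,0,\ldots,k\}$ is a map $c$ with $c(x)\ne\sigma(e)c(y)$ for each edge $e=xy$; the chromatic polynomial $\chi(\lambda)$ is the polynomial whose value at $\lambda=2k+1$ counts proper colorings. -}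

module Defs where

open import Data.Nat as ℕ using (ℕ; zero; suc)
open import Data.Integer as ℤ using (ℤ; +_; -_; _-_; _*_; _^_)
open import Data.Fin using (Fin; toℕ; inject₁; fromℕ) renaming (zero to fzero; suc to fsuc)
open import Data.List using (List; []; _∷_; [_]; map; concatMap; allFin; length; filter; _++_)
open import Data.List.Relation.Unary.All using (All)
open import Data.Vec using (Vec; []; _∷_; lookup)
open import Data.Product using (_×_; _,_)
open import Relation.Nullary using (¬_; Dec)
open import Relation.Binary.PropositionalEquality using (_≡_)
import Data.List.Relation.Unary.All as All
open import Relation.Nullary using (¬?)
open import Data.Sum using (_⊎_)

data Sign : Set where
  pos neg : Sign

signZ : Sign → ℤ
signZ pos = + 1
signZ neg = - (+ 1)

record SignedGraph : Set where
  field
    nV    : ℕ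
    edges : List (Fin nV × Fin nV × Sign)
open SignedGraph public

-- Colors {-k,…,0,…,k} encoded as Fin (2k+1): i ↦ i - k.
colorVal : (k : ℕ) → Fin (suc (2 ℕ.* k)) → ℤ
colorVal k i = + toℕ i - + k

allVecs : ∀ {q} (m : ℕ) → List (Vec (Fin q) m)
allVecs zero = [ [] ]
allVecs {q} (suc m) = concatMap (λ c → map (c ∷_) (allVecs m)) (allFin q)

Proper : (G : SignedGraph) (k : ℕ) → Vec (Fin (suc (2 ℕ.* k))) (nV G) → Set
Proper G k c = All (λ { (x , y , s) → ¬ (colorVal k (lookup c x) ≡ signZ s * colorVal k (lookup c y)) }) (edges G)

proper? : (G : SignedGraph) (k : ℕ) → (c : Vec (Fin (suc (2 ℕ.* k))) (nV G)) → Dec (Proper G k c)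
proper? G k c = All.all? (λ { (x , y , s) → ¬? (colorVal k (lookup c x) ℤ.≟ signZ s * colorVal k (lookup c y)) }) (edges G)

numProper : SignedGraph → ℕ → ℕ
numProper G k = length (filter (proper? G k) (allVecs (nV G)))

-- B_m^1 with m = n + 2. Vertices Fin (n+2): u = 0, u_i = i, v = n+1.
-- Path edges u u_1 … u_{m-2} v (all positive) only for m ≥ 3; for m = 2 (n = 0)
-- B_2^1 is the digon by convention.
pathEdges : (n : ℕ) → List (Fin (suc (suc n)) × Fin (suc (suc n)) × Sign)
pathEdges zero = []
pathEdges (suc n) = map (λ i → (inject₁ i , fsuc i , pos)) (allFin (suc (suc n)))

B1 : (m : ℕ) → SignedGraph
B1 m = record { nV = m ; edges = es m }
  where
  es : (m : ℕ) → List (Fin m × Fin m × Sign)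
  es zero = []
  es (suc zero) = []
  es (suc (suc n)) = pathEdges n ++ ((fzero , fromℕ (suc n) , pos) ∷ (fzero , fromℕ (suc n) , neg) ∷ [])

sumTo : ℕ → (ℕ → ℤ) → ℤ
sumTo zero f = f 0
sumTo (suc N) f = sumTo N f ℤ.+ f (suc N)

gamma : (m : ℕ) → ℤ → ℤ
gamma m λ' = sumTo (m ℕ.∸ 2) (λ i → (- (+ 1)) ^ i * (λ' - + 1) ^ (m ℕ.∸ 2 ℕ.∸ i))

module Submission where

-- Fix the color a of u. The remaining vertices u₁ … u_{m-2} v carry a proper coloring exactly
-- when consecutive colors along the path u u₁ … v differ (positive edges) and the color of v
-- differs from both a and −a (the two parallel edges uv). So we count walks of length m − 1 in the
-- complete graph K_q on the q = 2k+1 colors that start at a and end outside {a, −a}. Walks from x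
-- of length L ending in a set S number |S| γ_L + [x ∈ S] (−1)^L, where γ_{L+1} = (q−1) γ_L + (−1)^L,
-- since a walk of length L + 1 from x is a step to some y ≠ x followed by a walk of length L from y.
-- Here a ∉ S_a, and |S_a| = q − 2 except for the self-opposite color 0, where it is q − 1;
-- summing over a gives (q(q−2) + 1) γ_{m−1} = (q−1)² γ_{m−1}, and γ_{m−1} is the γ_m of the statement.

open import Data.Bool using (true; false; if_then_else_)
open import Data.Nat as ℕ using (ℕ; zero; suc; _≤_; _≥_; _∸_; s≤s; z≤n)
import Data.Nat.Properties as ℕP
open import Data.Integer as ℤ using (ℤ; +_; -_; _-_; _^_; _+_; _*_; _⊖_)
import Data.Integer.Properties as ℤP
open import Data.Integer.Tactic.RingSolver using (solve-∀)
open import Data.Fin using (Fin; _≟_; opposite; toℕ; fromℕ; fromℕ<; inject₁)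
  renaming (zero to fzero; suc to fsuc)
open import Data.Fin.Properties as FinP using (0≢1+n)
open import Data.List using (List; []; _∷_; _++_; map; concatMap; tabulate; filter; length)
open import Data.List.Properties using (length-++; filter-++; filter-≐; filter-none)
open import Data.List.Relation.Unary.All using ([]; _∷_; universal)
import Data.List.Relation.Unary.All.Properties as AllP
open import Data.Vec using (Vec; []; _∷_; lookup)
open import Data.Product using (_×_; _,_; proj₁; proj₂)
open import Function using (_∘_; id)
open import Relation.Nullary using (¬_; Dec; yes; no; does; ¬?; _×-dec_; contradiction)
open import Relation.Binary.PropositionalEquality
open import Relation.Unary using (_≐_)
open import Algebra.Properties.Semiring.Sum ℤP.+-*-semiring
  using (sum; sum-syntax; sum-cong-≗; ∑-distrib-+; *-distribʳ-sum)

open import Defs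

𝟙 : ∀ {A : Set} → Dec A → ℤ
𝟙 A? = if does A? then + 1 else + 0

𝟙-¬ : ∀ {A : Set} (A? : Dec A) → 𝟙 (¬? A?) ≡ + 1 - 𝟙 A?
𝟙-¬ (yes _) = refl
𝟙-¬ (no _)  = refl

𝟙-× : ∀ {A B : Set} (A? : Dec A) (B? : Dec B) → 𝟙 (A? ×-dec B?) ≡ 𝟙 A? * 𝟙 B?
𝟙-× (yes _) (yes _) = refl
𝟙-× (yes _) (no _)  = refl
𝟙-× (no _)  (yes _) = refl
𝟙-× (no _)  (no _)  = refl

𝟙-no : ∀ {A : Set} (A? : Dec A) → ¬ A → 𝟙 A? ≡ + 0
𝟙-no (yes a) ¬a = contradiction a ¬a
𝟙-no (no _)  ¬a = refl

∑-const : ∀ q (c : ℤ) → ∑[ i < q ] c ≡ + q * c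
∑-const zero    c = refl
∑-const (suc q) c = trans (cong (_+_ c) (∑-const q c)) (lemma c (+ q))
  where
  lemma : ∀ c x → c + x * c ≡ (+ 1 + x) * c
  lemma = solve-∀

∑-distrib-- : ∀ {q} (f g : Fin q → ℤ) → ∑[ i < q ] (f i - g i) ≡ ∑[ i < q ] f i - ∑[ i < q ] g i
∑-distrib-- {zero}  f g = refl
∑-distrib-- {suc q} f g =
  trans (cong (_+_ (f fzero - g fzero)) (∑-distrib-- (f ∘ fsuc) (g ∘ fsuc)))
    (lemma (f fzero) (g fzero) (sum (f ∘ fsuc)) (sum (g ∘ fsuc)))
  where
  lemma : ∀ a b c d → (a - b) + (c - d) ≡ (a + c) - (b + d)
  lemma = solve-∀

∑-𝟙-none : ∀ {q} {P : Fin q → Set} (P? : ∀ c → Dec (P c)) (g : Fin q → ℤ) →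
  (∀ c → ¬ P c) → ∑[ c < q ] (𝟙 (P? c) * g c) ≡ + 0
∑-𝟙-none {zero}  P? g ¬P = refl
∑-𝟙-none {suc q} P? g ¬P with P? fzero
... | yes P0 = contradiction P0 (¬P fzero)
... | no _   = trans (ℤP.+-identityˡ _) (∑-𝟙-none (P? ∘ fsuc) (g ∘ fsuc) (¬P ∘ fsuc))

∑-𝟙-unique : ∀ {q} {P : Fin q → Set} (P? : ∀ c → Dec (P c)) (g : Fin q → ℤ) {x : Fin q} →
  (∀ c → P c → x ≡ c) → P x → ∑[ c < q ] (𝟙 (P? c) * g c) ≡ g x
∑-𝟙-unique {suc q} P? g {fzero} unique Px with P? fzero
... | no ¬P0 = contradiction Px ¬P0
... | yes _  = begin
  + 1 * g fzero + ∑[ c < q ] (𝟙 (P? (fsuc c)) * g (fsuc c))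
    ≡⟨ cong (_+_ (+ 1 * g fzero))
            (∑-𝟙-none (P? ∘ fsuc) (g ∘ fsuc) (λ c Pc → 0≢1+n (unique (fsuc c) Pc))) ⟩
  + 1 * g fzero + + 0
    ≡⟨ trans (ℤP.+-identityʳ _) (ℤP.*-identityˡ _) ⟩
  g fzero ∎
  where open ≡-Reasoning
∑-𝟙-unique {suc q} P? g {fsuc x} unique Px with P? fzero
... | yes P0 = contradiction (sym (unique fzero P0)) 0≢1+n
... | no _   =
  trans (ℤP.+-identityˡ _)
        (∑-𝟙-unique (P? ∘ fsuc) (g ∘ fsuc) (λ c → FinP.suc-injective ∘ unique (fsuc c)) Px)

∑-𝟙-single : ∀ {q} {P : Fin q → Set} (P? : ∀ c → Dec (P c)) {x : Fin q} →
  (∀ c → P c → x ≡ c) → P x → ∑[ c < q ] 𝟙 (P? c) ≡ + 1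
∑-𝟙-single P? unique Px =
  trans (sum-cong-≗ (λ c → sym (ℤP.*-identityʳ (𝟙 (P? c))))) (∑-𝟙-unique P? (λ _ → + 1) unique Px)

∑-𝟙-≟ : ∀ {q} (x : Fin q) (g : Fin q → ℤ) → ∑[ c < q ] (𝟙 (x ≟ c) * g c) ≡ g x
∑-𝟙-≟ x g = ∑-𝟙-unique (x ≟_) g (λ _ → id) refl

∑-except : ∀ {q} (x : Fin q) (g : Fin q → ℤ) →
  ∑[ c < q ] (𝟙 (¬? (x ≟ c)) * g c) ≡ ∑[ c < q ] g c - g x
∑-except {q} x g = begin
  ∑[ c < q ] (𝟙 (¬? (x ≟ c)) * g c)
    ≡⟨ sum-cong-≗ (λ c → trans (cong (_* g c) (𝟙-¬ (x ≟ c))) (lemma (𝟙 (x ≟ c)) (g c))) ⟩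
  ∑[ c < q ] (g c - 𝟙 (x ≟ c) * g c)
    ≡⟨ ∑-distrib-- g _ ⟩
  ∑[ c < q ] g c - ∑[ c < q ] (𝟙 (x ≟ c) * g c)
    ≡⟨ cong (_-_ (∑[ c < q ] g c)) (∑-𝟙-≟ x g) ⟩
  ∑[ c < q ] g c - g x ∎
  where
  open ≡-Reasoning
  lemma : ∀ i a → (+ 1 - i) * a ≡ a - i * a
  lemma = solve-∀

module _ {A B : Set} {P : B → Set} (P? : ∀ b → Dec (P b)) where

  length-filter-map : ∀ (f : A → B) xs → length (filter P? (map f xs)) ≡ length (filter (P? ∘ f) xs)
  length-filter-map f []       = refl
  length-filter-map f (x ∷ xs) with does (P? (f x))
  ... | true  = cong suc (length-filter-map f xs)
  ... | false = length-filter-map f xs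

  length-filter-concatMap : ∀ {q} (G : A → List B) (f : Fin q → A) →
    + length (filter P? (concatMap G (tabulate f))) ≡ ∑[ i < q ] (+ length (filter P? (G (f i))))
  length-filter-concatMap {zero}  G f = refl
  length-filter-concatMap {suc q} G f = begin
    + length (filter P? (G (f fzero) ++ concatMap G (tabulate (f ∘ fsuc))))
      ≡⟨ cong (+_ ∘ length) (filter-++ P? (G (f fzero)) _) ⟩
    + length (filter P? (G (f fzero)) ++ filter P? (concatMap G (tabulate (f ∘ fsuc))))
      ≡⟨ cong +_ (length-++ (filter P? (G (f fzero)))) ⟩
    + (length (filter P? (G (f fzero))) ℕ.+ length (filter P? (concatMap G (tabulate (f ∘ fsuc)))))
      ≡⟨ ℤP.pos-+ (length (filter P? (G (f fzero)))) _ ⟩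
    + length (filter P? (G (f fzero))) + + length (filter P? (concatMap G (tabulate (f ∘ fsuc))))
      ≡⟨ cong (_+_ (+ length (filter P? (G (f fzero))))) (length-filter-concatMap G (f ∘ fsuc)) ⟩
    ∑[ i < suc q ] (+ length (filter P? (G (f i)))) ∎
    where open ≡-Reasoning

module _ {q : ℕ} where

  count : ∀ {m} {P : Vec (Fin q) m → Set} → (∀ c → Dec (P c)) → ℤ
  count {m} P? = + length (filter P? (allVecs m))

  count-∷ : ∀ {m} {P : Vec (Fin q) (suc m) → Set} (P? : ∀ c → Dec (P c)) →
    count P? ≡ ∑[ a < q ] count (P? ∘ (a ∷_))
  count-∷ {m} P? = trans (length-filter-concatMap P? (λ a → map (a ∷_) (allVecs m)) id)
                         (sum-cong-≗ (λ a → cong +_ (length-filter-map P? (a ∷_) (allVecs m))))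

  count-[] : ∀ {P : Vec (Fin q) 0 → Set} (P? : ∀ c → Dec (P c)) → count P? ≡ 𝟙 (P? [])
  count-[] P? with does (P? [])
  ... | true  = refl
  ... | false = refl

  count-≐ : ∀ {m} {P R : Vec (Fin q) m → Set} (P? : ∀ c → Dec (P c)) (R? : ∀ c → Dec (R c)) →
    P ≐ R → count P? ≡ count R?
  count-≐ {m} P? R? P≐R = cong (+_ ∘ length) (filter-≐ P? R? P≐R (allVecs m))

  count-const-× : ∀ {m} {A : Set} {R : Vec (Fin q) m → Set} (A? : Dec A) (R? : ∀ c → Dec (R c)) →
    count (λ c → A? ×-dec R? c) ≡ 𝟙 A? * count R?
  count-const-× (yes a) R? = trans (count-≐ _ R? (proj₂ , (a ,_))) (sym (ℤP.*-identityˡ _))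
  count-const-× {m} (no ¬a) R? =
    cong (+_ ∘ length) (filter-none _ (universal (λ _ → ¬a ∘ proj₁) (allVecs m)))

WalkTo : ∀ {q L} → (Fin q → Set) → Fin q → Vec (Fin q) L → Set
WalkTo Q x []      = Q x
WalkTo Q x (y ∷ w) = ¬ x ≡ y × WalkTo Q y w

walkTo? : ∀ {q L} {Q : Fin q → Set} → (∀ b → Dec (Q b)) → ∀ x (w : Vec (Fin q) L) → Dec (WalkTo Q x w)
walkTo? Q? x []      = Q? x
walkTo? Q? x (y ∷ w) = ¬? (x ≟ y) ×-dec walkTo? Q? y w

AdjacentDistinct : ∀ {q L} → Vec (Fin q) (suc L) → Set
AdjacentDistinct {L = L} c = ∀ (i : Fin L) → ¬ lookup c (inject₁ i) ≡ lookup c (fsuc i)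

walkTo⇒ : ∀ {q L} {Q : Fin q → Set} x (w : Vec (Fin q) L) →
  WalkTo Q x w → AdjacentDistinct (x ∷ w) × Q (lookup (x ∷ w) (fromℕ L))
walkTo⇒ x []      Qx           = (λ ()) , Qx
walkTo⇒ x (y ∷ w) (x≢y , walk) with walkTo⇒ y w walk
... | distinct , Qend = (λ { fzero → x≢y ; (fsuc i) → distinct i }) , Qend

walkTo⇐ : ∀ {q L} {Q : Fin q → Set} x (w : Vec (Fin q) L) →
  AdjacentDistinct (x ∷ w) → Q (lookup (x ∷ w) (fromℕ L)) → WalkTo Q x w
walkTo⇐ x []      distinct Qend = Qend
walkTo⇐ x (y ∷ w) distinct Qend = distinct fzero , walkTo⇐ y w (distinct ∘ fsuc) Qend

γ : ℤ → ℕ → ℤ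
γ l zero    = + 0
γ l (suc L) = (l - + 1) * γ l L + (- + 1) ^ L

count-walkTo : ∀ {q} L {Q : Fin q → Set} (Q? : ∀ b → Dec (Q b)) x →
  count (walkTo? {L = L} Q? x) ≡ (∑[ b < q ] 𝟙 (Q? b)) * γ (+ q) L + 𝟙 (Q? x) * (- + 1) ^ L
count-walkTo zero Q? x = trans (count-[] (walkTo? Q? x)) (lemma (sum (𝟙 ∘ Q?)) (𝟙 (Q? x)))
  where
  lemma : ∀ s i → i ≡ s * + 0 + i * + 1
  lemma = solve-∀
count-walkTo {q} (suc L) Q? x = begin
  count (walkTo? {L = suc L} Q? x)
    ≡⟨ count-∷ (walkTo? Q? x) ⟩
  ∑[ c < q ] count (λ (w : Vec (Fin q) L) → ¬? (x ≟ c) ×-dec walkTo? Q? c w)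
    ≡⟨ sum-cong-≗ (λ c → trans (count-const-× {m = L} (¬? (x ≟ c)) (walkTo? Q? c))
                               (cong (𝟙 (¬? (x ≟ c)) *_) (count-walkTo L Q? c))) ⟩
  ∑[ c < q ] (𝟙 (¬? (x ≟ c)) * N c)
    ≡⟨ ∑-except x N ⟩
  ∑[ c < q ] N c - N x
    ≡⟨ cong (_- N x) (∑-distrib-+ (λ _ → s * d) (λ c → 𝟙 (Q? c) * e)) ⟩
  (∑[ c < q ] (s * d) + ∑[ c < q ] (𝟙 (Q? c) * e)) - N x
    ≡⟨ cong (λ t → t - N x) (cong₂ _+_ (∑-const q (s * d)) (sym (*-distribʳ-sum e (𝟙 ∘ Q?)))) ⟩
  (+ q * (s * d) + s * e) - N x
    ≡⟨ lemma (+ q) s d e (𝟙 (Q? x)) ⟩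
  s * γ (+ q) (suc L) + 𝟙 (Q? x) * (- + 1) ^ suc L ∎
  where
  open ≡-Reasoning
  s = ∑[ b < q ] 𝟙 (Q? b)
  d = γ (+ q) L
  e = (- + 1) ^ L
  N : Fin q → ℤ
  N c = s * d + 𝟙 (Q? c) * e
  lemma : ∀ l s d e i → (l * (s * d) + s * e) - (s * d + i * e) ≡ s * ((l - + 1) * d + e) + i * ((- + 1) * e)
  lemma = solve-∀

*-γ : ∀ l L → l * γ l L ≡ (l - + 1) ^ L - (- + 1) ^ L
*-γ l zero    = lemma l
  where
  lemma : ∀ l → l * + 0 ≡ + 1 - + 1
  lemma = solve-∀
*-γ l (suc L) = begin
  l * ((l - + 1) * γ l L + (- + 1) ^ L)      ≡⟨ lemma₁ l (γ l L) ((- + 1) ^ L) ⟩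
  (l - + 1) * (l * γ l L) + l * (- + 1) ^ L  ≡⟨ cong (λ t → (l - + 1) * t + l * (- + 1) ^ L) (*-γ l L) ⟩
  (l - + 1) * ((l - + 1) ^ L - (- + 1) ^ L) + l * (- + 1) ^ L
                                             ≡⟨ lemma₂ l ((l - + 1) ^ L) ((- + 1) ^ L) ⟩
  (l - + 1) ^ suc L - (- + 1) ^ suc L        ∎
  where
  open ≡-Reasoning
  lemma₁ : ∀ l d e → l * ((l - + 1) * d + e) ≡ (l - + 1) * (l * d) + l * e
  lemma₁ = solve-∀
  lemma₂ : ∀ l p e → (l - + 1) * (p - e) + l * e ≡ (l - + 1) * p - (- + 1) * e
  lemma₂ = solve-∀

sumTo-cong : ∀ N {f g : ℕ → ℤ} → (∀ i → i ≤ N → f i ≡ g i) → sumTo N f ≡ sumTo N g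
sumTo-cong zero    f≗g = f≗g 0 z≤n
sumTo-cong (suc N) f≗g =
  cong₂ _+_ (sumTo-cong N (λ i i≤N → f≗g i (ℕP.m≤n⇒m≤1+n i≤N))) (f≗g (suc N) ℕP.≤-refl)

*-distribˡ-sumTo : ∀ N c (f : ℕ → ℤ) → c * sumTo N f ≡ sumTo N (λ i → c * f i)
*-distribˡ-sumTo zero    c f = refl
*-distribˡ-sumTo (suc N) c f =
  trans (ℤP.*-distribˡ-+ c (sumTo N f) (f (suc N))) (cong (_+ c * f (suc N)) (*-distribˡ-sumTo N c f))

gamma-suc : ∀ n l → gamma (3 ℕ.+ n) l ≡ (l - + 1) * gamma (2 ℕ.+ n) l + (- + 1) ^ suc n
gamma-suc n l = cong₂ _+_ earlier-terms last-term
  where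
  term : ℕ → ℕ → ℤ
  term N i = (- + 1) ^ i * (l - + 1) ^ (N ∸ i)
  lemma : ∀ a t p → a * (t * p) ≡ t * (a * p)
  lemma = solve-∀
  earlier-terms : sumTo n (term (suc n)) ≡ (l - + 1) * sumTo n (term n)
  earlier-terms = trans
    (sumTo-cong n (λ i i≤n → trans (cong (λ e → (- + 1) ^ i * (l - + 1) ^ e) (ℕP.+-∸-assoc 1 i≤n))
                                   (lemma ((- + 1) ^ i) (l - + 1) ((l - + 1) ^ (n ∸ i)))))
    (sym (*-distribˡ-sumTo n (l - + 1) (term n)))
  last-term : term (suc n) (suc n) ≡ (- + 1) ^ suc n
  last-term = trans (cong (λ e → (- + 1) ^ suc n * (l - + 1) ^ e) (ℕP.n∸n≡0 n)) (ℤP.*-identityʳ _)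

γ≡gamma : ∀ n l → γ l (suc n) ≡ gamma (2 ℕ.+ n) l
γ≡gamma zero    l = lemma l
  where
  lemma : ∀ l → (l - + 1) * + 0 + + 1 ≡ + 1 * + 1
  lemma = solve-∀
γ≡gamma (suc n) l = trans (cong (λ t → (l - + 1) * t + (- + 1) ^ suc n) (γ≡gamma n l)) (sym (gamma-suc n l))

i≡-i⇒i≡0 : ∀ {i} → i ≡ - i → i ≡ + 0
i≡-i⇒i≡0 {i} i≡-i = ℤP.*-cancelˡ-≡ (+ 2) i (+ 0) (begin
  + 2 * i  ≡⟨ lemma i ⟩
  i + i    ≡⟨ cong (_+_ i) i≡-i ⟩
  i - i    ≡⟨ ℤP.+-inverseʳ i ⟩
  + 0      ∎)
  where
  open ≡-Reasoning
  lemma : ∀ i → + 2 * i ≡ i + i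
  lemma = solve-∀

signAct : ∀ {n} → Sign → Fin n → Fin n
signAct pos = id
signAct neg = opposite

module Coloring (k : ℕ) where

  q : ℕ
  q = suc (2 ℕ.* k)

  Color : Set
  Color = Fin q

  colorVal-injective : ∀ {a b : Color} → colorVal k a ≡ colorVal k b → a ≡ b
  colorVal-injective {a} {b} va≡vb = FinP.toℕ-injective (ℤP.+-injective (begin
    + toℕ a                       ≡⟨ lemma (+ toℕ a) (+ k) ⟨
    colorVal k a + + k            ≡⟨ cong (_+ + k) va≡vb ⟩
    colorVal k b + + k            ≡⟨ lemma (+ toℕ b) (+ k) ⟩
    + toℕ b                       ∎))
    where
    open ≡-Reasoning
    lemma : ∀ x k → (x - k) + k ≡ x
    lemma = solve-∀

  colorVal-opposite : ∀ (a : Color) → colorVal k (opposite a) ≡ - colorVal k a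
  colorVal-opposite a = begin
    + toℕ (opposite a) - + k      ≡⟨ cong (λ t → + t - + k) (FinP.opposite-prop a) ⟩
    + (2 ℕ.* k ∸ toℕ a) - + k     ≡⟨ cong (_- + k) (sym (ℤP.⊖-≥ (FinP.toℕ≤pred[n] a))) ⟩
    (2 ℕ.* k ⊖ toℕ a) - + k       ≡⟨ cong (_- + k) (sym (ℤP.m-n≡m⊖n (2 ℕ.* k) (toℕ a))) ⟩
    + (2 ℕ.* k) - + toℕ a - + k   ≡⟨ cong (λ t → t - + toℕ a - + k) (ℤP.pos-* 2 k) ⟩
    + 2 * + k - + toℕ a - + k     ≡⟨ lemma (+ k) (+ toℕ a) ⟩
    - (+ toℕ a - + k)             ∎
    where
    open ≡-Reasoning
    lemma : ∀ k t → + 2 * k - t - k ≡ - (t - k)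
    lemma = solve-∀

  signZ-*-colorVal : ∀ s (b : Color) → signZ s * colorVal k b ≡ colorVal k (signAct s b)
  signZ-*-colorVal pos b = ℤP.*-identityˡ (colorVal k b)
  signZ-*-colorVal neg b = trans (ℤP.-1*i≡-i (colorVal k b)) (sym (colorVal-opposite b))

  conflict-free⇒≢ : ∀ s {a b : Color} → ¬ colorVal k a ≡ signZ s * colorVal k b → ¬ a ≡ signAct s b
  conflict-free⇒≢ s {a} {b} ok a≡sb = ok (trans (cong (colorVal k) a≡sb) (sym (signZ-*-colorVal s b)))

  ≢⇒conflict-free : ∀ s {a b : Color} → ¬ a ≡ signAct s b → ¬ colorVal k a ≡ signZ s * colorVal k b
  ≢⇒conflict-free s {a} {b} a≢sb va≡svb = a≢sb (colorVal-injective (trans va≡svb (signZ-*-colorVal s b)))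

  middle : Color
  middle = fromℕ< (s≤s (ℕP.m≤m+n k (k ℕ.+ 0)))

  colorVal-middle : colorVal k middle ≡ + 0
  colorVal-middle = trans (cong (λ t → + t - + k) (FinP.toℕ-fromℕ< (s≤s (ℕP.m≤m+n k (k ℕ.+ 0)))))
                          (ℤP.+-inverseʳ (+ k))

  middle-self-opposite : middle ≡ opposite middle
  middle-self-opposite = colorVal-injective
    (trans colorVal-middle (sym (trans (colorVal-opposite middle) (cong -_ colorVal-middle))))

  self-opposite⇒middle : ∀ (a : Color) → a ≡ opposite a → middle ≡ a
  self-opposite⇒middle a a≡-a = colorVal-injective (trans colorVal-middle (sym
    (i≡-i⇒i≡0 (trans (cong (colorVal k) a≡-a) (colorVal-opposite a)))))

  Avoids : Color → Color → Set
  Avoids a b = ¬ a ≡ b × ¬ a ≡ opposite b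

  avoids? : ∀ a b → Dec (Avoids a b)
  avoids? a b = ¬? (a ≟ b) ×-dec ¬? (a ≟ opposite b)

  proper⇒walkTo : ∀ n a (w : Vec Color (suc n)) → Proper (B1 (2 ℕ.+ n)) k (a ∷ w) → WalkTo (Avoids a) a w
  proper⇒walkTo zero    a (b ∷ []) (ok₊ ∷ ok₋ ∷ []) =
    conflict-free⇒≢ pos ok₊ , conflict-free⇒≢ pos ok₊ , conflict-free⇒≢ neg ok₋
  proper⇒walkTo (suc n) a w proper with AllP.++⁻ (pathEdges (suc n)) proper
  ... | path-ok , (ok₊ ∷ ok₋ ∷ []) = walkTo⇐ a w
    (conflict-free⇒≢ pos ∘ AllP.tabulate⁻ {f = id} (AllP.map⁻ path-ok))
    (conflict-free⇒≢ pos ok₊ , conflict-free⇒≢ neg ok₋)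

  walkTo⇒proper : ∀ n a (w : Vec Color (suc n)) → WalkTo (Avoids a) a w → Proper (B1 (2 ℕ.+ n)) k (a ∷ w)
  walkTo⇒proper zero    a (b ∷ []) (_ , a≢b , a≢-b) =
    ≢⇒conflict-free pos a≢b ∷ ≢⇒conflict-free neg a≢-b ∷ []
  walkTo⇒proper (suc n) a w walk with walkTo⇒ a w walk
  ... | distinct , (a≢b , a≢-b) = AllP.++⁺
    (AllP.map⁺ (AllP.tabulate⁺ {f = id} (≢⇒conflict-free pos ∘ distinct)))
    (≢⇒conflict-free pos a≢b ∷ ≢⇒conflict-free neg a≢-b ∷ [])

  ∑-avoids : ∀ a → ∑[ b < q ] 𝟙 (avoids? a b) ≡ + q - + 2 + 𝟙 (a ≟ opposite a)
  ∑-avoids a = begin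
    ∑[ b < q ] 𝟙 (avoids? a b)
      ≡⟨ sum-cong-≗ (λ b → trans (𝟙-× (¬? (a ≟ b)) (¬? (a ≟ opposite b)))
                                 (cong₂ _*_ (𝟙-¬ (a ≟ b)) (𝟙-¬ (a ≟ opposite b)))) ⟩
    ∑[ b < q ] ((+ 1 - A b) * (+ 1 - B b))
      ≡⟨ sum-cong-≗ (λ b → lemma₁ (A b) (B b)) ⟩
    ∑[ b < q ] ((+ 1 - A b) - B b + A b * B b)
      ≡⟨ ∑-distrib-+ (λ b → (+ 1 - A b) - B b) (λ b → A b * B b) ⟩
    ∑[ b < q ] ((+ 1 - A b) - B b) + ∑[ b < q ] (A b * B b)
      ≡⟨ cong (_+ ∑[ b < q ] (A b * B b)) (trans (∑-distrib-- (λ b → + 1 - A b) B)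
                                                 (cong (_- sum B) (∑-distrib-- (λ _ → + 1) A))) ⟩
    sum {q} (λ _ → + 1) - sum A - sum B + ∑[ b < q ] (A b * B b)
      ≡⟨ cong₂ _+_ (cong₂ _-_ (cong₂ _-_ (∑-const q (+ 1)) ∑A) ∑B) (∑-𝟙-≟ a B) ⟩
    + q * + 1 - + 1 - + 1 + 𝟙 (a ≟ opposite a)
      ≡⟨ lemma₂ (+ q) (𝟙 (a ≟ opposite a)) ⟩
    + q - + 2 + 𝟙 (a ≟ opposite a) ∎
    where
    open ≡-Reasoning
    A B : Color → ℤ
    A b = 𝟙 (a ≟ b)
    B b = 𝟙 (a ≟ opposite b)
    ∑A : sum A ≡ + 1
    ∑A = ∑-𝟙-single (a ≟_) (λ _ → id) refl
    ∑B : sum B ≡ + 1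
    ∑B = ∑-𝟙-single (λ b → a ≟ opposite b)
                    (λ c a≡-c → trans (cong opposite a≡-c) (FinP.opposite-involutive c))
                    (sym (FinP.opposite-involutive a))
    lemma₁ : ∀ x y → (+ 1 - x) * (+ 1 - y) ≡ (+ 1 - x) - y + x * y
    lemma₁ = solve-∀
    lemma₂ : ∀ q i → q * + 1 - + 1 - + 1 + i ≡ q - + 2 + i
    lemma₂ = solve-∀

  ∑-self-opposite : ∑[ a < q ] 𝟙 (a ≟ opposite a) ≡ + 1
  ∑-self-opposite = ∑-𝟙-single (λ a → a ≟ opposite a) self-opposite⇒middle middle-self-opposite

  ∑∑-avoids : ∑[ a < q ] ∑[ b < q ] 𝟙 (avoids? a b) ≡ + q * (+ q - + 2) + + 1
  ∑∑-avoids = begin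
    ∑[ a < q ] ∑[ b < q ] 𝟙 (avoids? a b)
      ≡⟨ sum-cong-≗ ∑-avoids ⟩
    ∑[ a < q ] (+ q - + 2 + 𝟙 (a ≟ opposite a))
      ≡⟨ ∑-distrib-+ {n = q} (λ _ → + q - + 2) (λ a → 𝟙 (a ≟ opposite a)) ⟩
    ∑[ a < q ] (+ q - + 2) + ∑[ a < q ] 𝟙 (a ≟ opposite a)
      ≡⟨ cong₂ _+_ (∑-const q (+ q - + 2)) ∑-self-opposite ⟩
    + q * (+ q - + 2) + + 1 ∎
    where open ≡-Reasoning

  properB1≐walkTo : ∀ n a → (Proper (B1 (2 ℕ.+ n)) k ∘ (a ∷_)) ≐ WalkTo (Avoids a) a
  properB1≐walkTo n a = (λ {w} → proper⇒walkTo n a w) , (λ {w} → walkTo⇒proper n a w)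

  count-properB1 : ∀ n → count (proper? (B1 (2 ℕ.+ n)) k) ≡ (+ q - + 1) ^ 2 * γ (+ q) (suc n)
  count-properB1 n = begin
    count (proper? (B1 (2 ℕ.+ n)) k)
      ≡⟨ count-∷ (proper? (B1 (2 ℕ.+ n)) k) ⟩
    ∑[ a < q ] count (proper? (B1 (2 ℕ.+ n)) k ∘ (a ∷_))
      ≡⟨ sum-cong-≗ (λ a → count-≐ (proper? (B1 (2 ℕ.+ n)) k ∘ (a ∷_)) (walkTo? (avoids? a) a)
                                   (properB1≐walkTo n a)) ⟩
    ∑[ a < q ] count (walkTo? {L = suc n} (avoids? a) a)
      ≡⟨ sum-cong-≗ (λ a → count-walkTo (suc n) (avoids? a) a) ⟩
    ∑[ a < q ] (s a * d + 𝟙 (avoids? a a) * (- + 1) ^ suc n)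
      ≡⟨ sum-cong-≗ (λ a → cong (λ t → s a * d + t * (- + 1) ^ suc n)
                                (𝟙-no (avoids? a a) (λ a≢a → proj₁ a≢a refl))) ⟩
    ∑[ a < q ] (s a * d + + 0)
      ≡⟨ sum-cong-≗ (λ a → ℤP.+-identityʳ (s a * d)) ⟩
    ∑[ a < q ] (s a * d)
      ≡⟨ *-distribʳ-sum d s ⟨
    sum s * d
      ≡⟨ cong (_* d) ∑∑-avoids ⟩
    (+ q * (+ q - + 2) + + 1) * d
      ≡⟨ lemma (+ q) d ⟩
    (+ q - + 1) ^ 2 * d ∎
    where
    open ≡-Reasoning
    d = γ (+ q) (suc n)
    s : Color → ℤ
    s a = ∑[ b < q ] 𝟙 (avoids? a b)
    lemma : ∀ q d → (q * (q - + 2) + + 1) * d ≡ (q - + 1) * ((q - + 1) * + 1) * d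
    lemma = solve-∀

lemma3p4 : (m : ℕ) → m ≥ 2 → (k : ℕ) →
    (+ numProper (B1 m) k ≡ ((+ (2 ℕ.* k ℕ.+ 1)) - + 1) ^ 2 * gamma m (+ (2 ℕ.* k ℕ.+ 1)))
    × ((+ (2 ℕ.* k ℕ.+ 1)) * gamma m (+ (2 ℕ.* k ℕ.+ 1))
    ≡ ((+ (2 ℕ.* k ℕ.+ 1)) - + 1) ^ (m ∸ 1) - (- (+ 1)) ^ (m ∸ 1))
lemma3p4 (suc zero)    (s≤s ()) k
lemma3p4 (suc (suc n)) _        k rewrite ℕP.+-comm (2 ℕ.* k) 1 =
    trans (count-properB1 n) (cong ((+ q - + 1) ^ 2 *_) (γ≡gamma n (+ q)))
  , trans (cong (+ q *_) (sym (γ≡gamma n (+ q)))) (*-γ (+ q) (suc n))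
  where open Coloring k using (q; count-properB1)
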